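{- Let $G=(V,E)$ be a strongly connected directed graph, let $v\in V$, and let $C$ be a $2$-vertex-connected component of $G$. Then, in the dominator tree $DT(v)$ of the flowgraph $G(v)$, either there is a vertex $w\notin C$ such that every element of $C$ is a child of $w$, or there is a vertex $w\in C$ such that every element of $C\setminus\{w\}$ is a child of $w$.
   Context: For $U\subseteq V$, $G[U]$ is the induced subgraph. $G$ is $2$-vertex-connected if it has at least $3$ vertices and $G[V\setminus X]$ is strongly connected for every $X\subset V$ with $|X|<2$; the $2$-vertex-connected components of $G$ are its maximal $2$-vertex-connected subgraphs (identified with vertex sets $C$, subgraph $G[C]$). The flowgraph $G(v)$ is $G$ with start vertex $v$. A vertex $w$ dominates $u$ in $G(v)$ if every path from $v$ to $u$ contains $w$. Every $u\neq v$ has a unique immediate dominator $\mathrm{imd}(u)$: a dominator of $u$ different from $u$ that is dominated by all other dominators of $u$ different from $u$. The edges $(\mathrm{imd}(u),u)$ form the dominator tree $DT(v)$ rooted at $v$; the children (direct successors) of $w$ in $DT(v)$ are the vertices $u$ with $\mathrm{imd}(u)=w$. -}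

module Defs where

open import Data.Nat using (ℕ)
open import Data.Fin using (Fin)
open import Data.Bool using (Bool; true)
open import Data.Product using (Σ; _×_; ∃; ∃-syntax)
open import Data.Sum using (_⊎_)
open import Data.Unit using (⊤)
open import Relation.Nullary using (¬_)
open import Relation.Unary using (Pred; _∈_; _∉_; _⊆_)
open import Relation.Binary.PropositionalEquality using (_≡_; _≢_)
open import Level using (0ℓ)

Digraph : ℕ → Set
Digraph n = Fin n → Fin n → Bool

VSet : ℕ → Set₁
VSet n = Pred (Fin n) 0ℓ

module _ {n : ℕ} (G : Digraph n) where

  -- Walks a → b in the induced subgraph G[U] (every vertex lies in U).
  data Walk (U : VSet n) : Fin n → Fin n → Set where
    here : ∀ {a} → a ∈ U → Walk U a a
    step : ∀ {a b c} → a ∈ U → G a b ≡ true → Walk U b c → Walk U a c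

  data Visits {U : VSet n} (w : Fin n) : ∀ {a b} → Walk U a b → Set where
    vhere  : ∀ {u} → Visits w (here {U = U} {a = w} u)
    vstepH : ∀ {b c} {u : w ∈ U} {e : G w b ≡ true} {p : Walk U b c} → Visits w (step u e p)
    vstepT : ∀ {a b c} {u : a ∈ U} {e : G a b ≡ true} {p : Walk U b c} → Visits w p → Visits w (step u e p)

  StronglyConnected : VSet n → Set
  StronglyConnected U = ∀ a b → a ∈ U → b ∈ U → Walk U a b

  Full : VSet n
  Full _ = ⊤

  _∖_ : VSet n → VSet n → VSet n
  (U ∖ X) x = x ∈ U × x ∉ X

  Empty : VSet n
  Empty _ = Data.Empty.⊥ where import Data.Empty

  Single : Fin n → VSet n
  Single x y = y ≡ x

  -- G[U] is 2-vertex-connected: at least 3 vertices, and G[U ∖ X] strongly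
  -- connected for every X ⊆ U with |X| < 2 (X empty or a singleton of U).
  TwoVertexConnected : VSet n → Set
  TwoVertexConnected U =
    (∃[ a ] ∃[ b ] ∃[ c ] (a ∈ U × b ∈ U × c ∈ U × a ≢ b × a ≢ c × b ≢ c))
    × StronglyConnected (U ∖ Empty)
    × (∀ x → x ∈ U → StronglyConnected (U ∖ Single x))

  TwoVCC : VSet n → Set₁
  TwoVCC C = TwoVertexConnected C × (∀ (D : VSet n) → C ⊆ D → TwoVertexConnected D → D ⊆ C)

  Dominates : Fin n → Fin n → Fin n → Set
  Dominates v w u = ∀ (p : Walk Full v u) → Visits w p

  IsImd : Fin n → Fin n → Fin n → Set
  IsImd v w u =
    u ≢ v × w ≢ u × Dominates v w u
    × (∀ d → Dominates v d u → d ≢ u → Dominates v d w)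

  ChildInDT : Fin n → Fin n → Fin n → Set
  ChildInDT v w u = IsImd v w u

module Submission where

-- The whole argument rests on
-- one propagation fact: if d dominates some u ∈ C with d ≠ u, then d dominates
-- every x ∈ C other than d, because x reaches u inside G[C ∖ {d}].  The proof
-- splits on whether some vertex of C dominates another vertex of C.
--  * If c ∈ C dominates some other vertex of C, it dominates all of C ∖ {c},
--    and every dominator d ≠ u of such a u dominates c as well; so C ∖ {c} is
--    a set of children of c.  (This covers v ∈ C, with c = v.)
--  * Otherwise v ∉ C.  On a walk from v to some a ∈ C let w be the last vertex
--    outside C that dominates a.  Then w dominates all of C, and every other
--    dominator d of a vertex of C lies outside C, dominates a, and hence
--    dominates w; so all of C are children of w.
-- Since the logic is constructive, the case split needs decidability: we show
-- that walks inside a decidable vertex set, domination and 2-vertex-connectivity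
-- of a decidable set are decidable, and that the component C itself is
-- decidable (x ∈ C iff x lies in a 2-vertex-connected set coded by a Boolean
-- vector that also contains two fixed vertices of C).

open import Defs
open import Data.Nat using (ℕ; zero; suc; _+_; _≤_; _<_; z≤n; s≤s)
open import Data.Nat.Properties using (≤-refl; +-mono-≤; +-mono-<-≤; +-mono-≤-<; <-≤-trans; n≮0; m<1+n⇒m≤n)
open import Data.Fin using (Fin; _≟_) renaming (zero to fzero; suc to fsuc)
open import Data.Fin.Properties using (any?; all?)
open import Data.Fin.Subset using (Subset)
open import Data.Fin.Subset.Properties using (anySubset?)
open import Data.Bool using (true)
import Data.Bool.Properties as Bool
open import Data.Vec using (lookup; tabulate)
open import Data.Vec.Properties using (lookup∘tabulate)
open import Data.Product using (Σ; _×_; _,_; proj₁; proj₂; ∃; ∃-syntax)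
open import Data.Sum using (_⊎_; inj₁; inj₂)
open import Data.Unit using (tt)
open import Data.Empty using (⊥-elim)
open import Function using (_∘_)
open import Relation.Nullary using (¬_; Dec; yes; no; does)
open import Relation.Nullary.Decidable using (_×-dec_; _→-dec_; ¬?; map′; ¬¬-excluded-middle; dec-true)
open import Relation.Unary using (_∈_; _∉_; _⊆_; Decidable)
open import Relation.Binary.PropositionalEquality using (_≡_; _≢_; refl; sym; trans; subst)

sumFin : ∀ {m} → (Fin m → ℕ) → ℕ
sumFin {zero}  f = 0
sumFin {suc m} f = f fzero + sumFin (f ∘ fsuc)

sumFin-mono : ∀ {m} (f g : Fin m → ℕ) → (∀ i → f i ≤ g i) → sumFin f ≤ sumFin g
sumFin-mono {zero}  f g f≤g = z≤n
sumFin-mono {suc m} f g f≤g = +-mono-≤ (f≤g fzero) (sumFin-mono (f ∘ fsuc) (g ∘ fsuc) (f≤g ∘ fsuc))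

sumFin-strict : ∀ {m} (f g : Fin m → ℕ) → (∀ i → f i ≤ g i) → ∀ j → f j < g j → sumFin f < sumFin g
sumFin-strict {suc m} f g f≤g fzero    f<g = +-mono-<-≤ f<g (sumFin-mono (f ∘ fsuc) (g ∘ fsuc) (f≤g ∘ fsuc))
sumFin-strict {suc m} f g f≤g (fsuc j) f<g = +-mono-≤-< (f≤g fzero) (sumFin-strict (f ∘ fsuc) (g ∘ fsuc) (f≤g ∘ fsuc) j f<g)

indicator : ∀ {A : Set} → Dec A → ℕ
indicator (yes _) = 1
indicator (no _)  = 0

indicator-mono : ∀ {A B : Set} (A? : Dec A) (B? : Dec B) → (A → B) → indicator A? ≤ indicator B?
indicator-mono (yes a) (yes _) A→B = ≤-refl
indicator-mono (yes a) (no ¬b) A→B = ⊥-elim (¬b (A→B a))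
indicator-mono (no _)  B?      A→B = z≤n

indicator-strict : ∀ {A B : Set} (A? : Dec A) (B? : Dec B) → ¬ A → B → indicator A? < indicator B?
indicator-strict (yes a) B?      ¬a b = ⊥-elim (¬a a)
indicator-strict (no _)  (yes _) ¬a b = s≤s z≤n
indicator-strict (no _)  (no ¬b) ¬a b = ⊥-elim (¬b b)

does-true⇒ : ∀ {A : Set} (A? : Dec A) → does A? ≡ true → A
does-true⇒ (yes a) _ = a
does-true⇒ (no _)  ()

¬¬-decidable : ∀ {m} (U : Fin m → Set) → ¬ ¬ (∀ i → Dec (U i))
¬¬-decidable {zero}  U k = k (λ ())
¬¬-decidable {suc m} U k =
  ¬¬-excluded-middle λ U₀? → ¬¬-decidable (U ∘ fsuc) λ U₊? →
    k λ { fzero → U₀? ; (fsuc i) → U₊? i }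

⟦_⟧ : ∀ {n} → Subset n → VSet n
⟦ S ⟧ x = lookup S x ≡ true

code : ∀ {n} {U : VSet n} → Decidable U → Subset n
code U? = tabulate (does ∘ U?)

code-⊆ : ∀ {n} {U : VSet n} (U? : Decidable U) → U ⊆ ⟦ code U? ⟧
code-⊆ U? {x} x∈U = trans (lookup∘tabulate _ x) (dec-true (U? x) x∈U)

code-⊇ : ∀ {n} {U : VSet n} (U? : Decidable U) → ⟦ code U? ⟧ ⊆ U
code-⊇ U? {x} x∈S = does-true⇒ (U? x) (trans (sym (lookup∘tabulate _ x)) x∈S)

module _ {n : ℕ} (G : Digraph n) where

  _⊖_ : VSet n → Fin n → VSet n
  U ⊖ w = _∖_ G U (Single G w)

  _∪_ : VSet n → VSet n → VSet n
  (U ∪ U') x = U x ⊎ U' x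

  weaken : ∀ {U U' : VSet n} → U ⊆ U' → ∀ {a b} → Walk G U a b → Walk G U' a b
  weaken U⊆U' (here a∈U)     = here (U⊆U' a∈U)
  weaken U⊆U' (step a∈U e p) = step (U⊆U' a∈U) e (weaken U⊆U' p)

  toFull : ∀ {U a b} → Walk G U a b → Walk G (Full G) a b
  toFull = weaken (λ _ → tt)

  _++_ : ∀ {U a b c} → Walk G U a b → Walk G U b c → Walk G U a c
  here _       ++ q = q
  step a∈U e p ++ q = step a∈U e (p ++ q)

  start-in : ∀ {U a b} → Walk G U a b → a ∈ U
  start-in (here a∈U)     = a∈U
  start-in (step a∈U _ _) = a∈U

  visits-start : ∀ {U a b} (p : Walk G U a b) → Visits G a p
  visits-start (here _)     = vhere
  visits-start (step _ _ _) = vstepH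

  visits-end : ∀ {U a b} (p : Walk G U a b) → Visits G b p
  visits-end (here _)     = vhere
  visits-end (step _ _ p) = vstepT (visits-end p)

  visited-in : ∀ {U a b w} (p : Walk G U a b) → Visits G w p → w ∈ U
  visited-in (here w∈U)     vhere      = w∈U
  visited-in (step w∈U _ _) vstepH     = w∈U
  visited-in (step _ _ p)   (vstepT v) = visited-in p v

  visits-weaken : ∀ {U U' : VSet n} (U⊆U' : U ⊆ U') {a b w} (p : Walk G U a b) → Visits G w (weaken U⊆U' p) → Visits G w p
  visits-weaken U⊆U' (here _)     vhere      = vhere
  visits-weaken U⊆U' (step _ _ p) vstepH     = vstepH
  visits-weaken U⊆U' (step _ _ p) (vstepT v) = vstepT (visits-weaken U⊆U' p v)

  visits-++ : ∀ {U a b c w} (p : Walk G U a b) (q : Walk G U b c) → Visits G w (p ++ q) → Visits G w p ⊎ Visits G w q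
  visits-++ (here _)     q v          = inj₂ v
  visits-++ (step _ _ p) q vstepH     = inj₁ vstepH
  visits-++ (step _ _ p) q (vstepT v) with visits-++ p q v
  ... | inj₁ vp = inj₁ (vstepT vp)
  ... | inj₂ vq = inj₂ vq

  visits? : ∀ {U a b} w (p : Walk G U a b) → Dec (Visits G w p)
  visits? w (here {a} _) with w ≟ a
  ... | yes refl = yes vhere
  ... | no w≢a   = no λ { vhere → w≢a refl }
  visits? w (step {a} _ _ p) with w ≟ a | visits? w p
  ... | yes refl | _      = yes vstepH
  ... | no w≢a   | yes v  = yes (vstepT v)
  ... | no w≢a   | no ¬v  = no λ { vstepH → w≢a refl ; (vstepT v) → ¬v v }

  avoid : ∀ {U a b w} (p : Walk G U a b) → ¬ Visits G w p → Walk G (U ⊖ w) a b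
  avoid (here a∈U)     ¬v = here (a∈U , λ { refl → ¬v vhere })
  avoid (step a∈U e p) ¬v = step (a∈U , λ { refl → ¬v vstepH }) e (avoid p (¬v ∘ vstepT))

  lastExit : ∀ {U a x b} → a ≢ b → Walk G U x b →
             Walk G (U ⊖ a) x b ⊎ (∃ λ c → G a c ≡ true × Walk G (U ⊖ a) c b)
  lastExit a≢b (here b∈U) = inj₁ (here (b∈U , a≢b ∘ sym))
  lastExit {a = a} a≢b (step {x} x∈U e p) with lastExit a≢b p | x ≟ a
  ... | inj₂ exit | _        = inj₂ exit
  ... | inj₁ q    | yes refl = inj₂ (_ , e , q)
  ... | inj₁ q    | no x≢a   = inj₁ (step (x∈U , x≢a) e q)

  lastVisit : ∀ {Q : VSet n} → Decidable Q → ∀ {U s t} (p : Walk G U s t) →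
              (∃ λ z → Q z × Σ (Walk G U z t) λ r → ∀ y → Q y → Visits G y r → y ≡ z)
              ⊎ (∀ y → Q y → ¬ Visits G y p)
  lastVisit Q? (here {s} s∈U) with Q? s
  ... | yes Qs = inj₁ (s , Qs , here s∈U , λ { y Qy vhere → refl })
  ... | no ¬Qs = inj₂ λ { y Qy vhere → ¬Qs Qy }
  lastVisit Q? (step {s} s∈U e p) with lastVisit Q? p | Q? s
  ... | inj₁ suffix | _      = inj₁ suffix
  ... | inj₂ none   | yes Qs = inj₁ (s , Qs , step s∈U e p ,
                                     λ { y Qy vstepH → refl ; y Qy (vstepT v) → ⊥-elim (none y Qy v) })
  ... | inj₂ none   | no ¬Qs = inj₂ λ { y Qy vstepH → ¬Qs Qy ; y Qy (vstepT v) → none y Qy v }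

  remove? : ∀ {U : VSet n} → Decidable U → ∀ w → Decidable (U ⊖ w)
  remove? U? w x = U? x ×-dec ¬? (x ≟ w)

  size : ∀ {U : VSet n} → Decidable U → ℕ
  size U? = sumFin (indicator ∘ U?)

  size-remove : ∀ {U : VSet n} (U? : Decidable U) a → a ∈ U → size (remove? U? a) < size U?
  size-remove U? a a∈U = sumFin-strict (indicator ∘ remove? U? a) (indicator ∘ U?)
    (λ i → indicator-mono (remove? U? a i) (U? i) proj₁) a
    (indicator-strict (remove? U? a a) (U? a) (λ a∈U⊖a → proj₂ a∈U⊖a refl) a∈U)

  -- A walk a ⇝ b (a ≠ b) in U exists iff some edge (a , c) is followed by a walk
  -- c ⇝ b in U ⊖ a; recursion on an upper bound k of the size of U.
  walk?-bounded : ∀ k {U : VSet n} (U? : Decidable U) → size U? ≤ k → ∀ a b → Dec (Walk G U a b)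
  walk?-bounded k U? size≤k a b with U? a | a ≟ b
  ... | no a∉U | _        = no (a∉U ∘ start-in)
  ... | yes a∈U | yes refl = yes (here a∈U)
  walk?-bounded zero U? size≤0 a b | yes a∈U | no a≢b =
    ⊥-elim (n≮0 (<-≤-trans (size-remove U? a a∈U) size≤0))
  walk?-bounded (suc k) {U} U? size≤k a b | yes a∈U | no a≢b =
    map′ (λ { (c , e , q) → step a∈U e (weaken proj₁ q) }) exit
         (any? λ c → (G a c Bool.≟ true) ×-dec walk?-bounded k (remove? U? a) smaller c b)
    where
    smaller : size (remove? U? a) ≤ k
    smaller = m<1+n⇒m≤n (<-≤-trans (size-remove U? a a∈U) size≤k)
    exit : Walk G U a b → ∃ λ c → G a c ≡ true × Walk G (U ⊖ a) c b
    exit p with lastExit a≢b p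
    ... | inj₂ e = e
    ... | inj₁ q = ⊥-elim (proj₂ (start-in q) refl)

  walk? : ∀ {U : VSet n} → Decidable U → ∀ a b → Dec (Walk G U a b)
  walk? U? = walk?-bounded _ U? ≤-refl

  sc-≐ : ∀ {U U' : VSet n} → U ⊆ U' → U' ⊆ U → StronglyConnected G U → StronglyConnected G U'
  sc-≐ U⊆U' U'⊆U sc a b a∈U' b∈U' = weaken U⊆U' (sc a b (U'⊆U a∈U') (U'⊆U b∈U'))

  tvc-≐ : ∀ {U U' : VSet n} → U ⊆ U' → U' ⊆ U → TwoVertexConnected G U → TwoVertexConnected G U'
  tvc-≐ U⊆U' U'⊆U ((a , b , c , a∈U , b∈U , c∈U , distinct) , sc , sc₁) =
    (a , b , c , U⊆U' a∈U , U⊆U' b∈U , U⊆U' c∈U , distinct)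
    , sc-≐ (λ (x∈U , x∉X) → U⊆U' x∈U , x∉X) (λ (x∈U' , x∉X) → U'⊆U x∈U' , x∉X) sc
    , λ x x∈U' → sc-≐ (λ (y∈U , y≢x) → U⊆U' y∈U , y≢x) (λ (y∈U' , y≢x) → U'⊆U y∈U' , y≢x) (sc₁ x (U'⊆U x∈U'))

  walkWithin : ∀ {C : VSet n} → TwoVertexConnected G C → ∀ {p q} → p ∈ C → q ∈ C → Walk G C p q
  walkWithin (_ , sc , _) p∈C q∈C = weaken proj₁ (sc _ _ (p∈C , λ ()) (q∈C , λ ()))

  sc-⊖ : ∀ {C : VSet n} → TwoVertexConnected G C → ∀ y → StronglyConnected G (C ⊖ y)
  sc-⊖ tC@(_ , _ , sc₁) y p q (p∈C , p≢y) (q∈C , q≢y) with visits? y (walkWithin tC p∈C q∈C)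
  ... | yes v = sc₁ y (visited-in (walkWithin tC p∈C q∈C) v) p q (p∈C , p≢y) (q∈C , q≢y)
  ... | no ¬v = avoid (walkWithin tC p∈C q∈C) ¬v

  tvc? : ∀ {U : VSet n} → Decidable U → Dec (TwoVertexConnected G U)
  tvc? U? =
    (any? λ a → any? λ b → any? λ c →
       U? a ×-dec U? b ×-dec U? c ×-dec ¬? (a ≟ b) ×-dec ¬? (a ≟ c) ×-dec ¬? (b ≟ c))
    ×-dec sc? (λ x → U? x ×-dec yes (λ ()))
    ×-dec (all? λ x → U? x →-dec sc? (remove? U? x))
    where
    sc? : ∀ {W : VSet n} → Decidable W → Dec (StronglyConnected G W)
    sc? W? = all? λ a → all? λ b → W? a →-dec (W? b →-dec walk? W? a b)

  sc-∪∖ : ∀ {C S X : VSet n} z → z ∈ _∖_ G C X → z ∈ _∖_ G S X →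
          StronglyConnected G (_∖_ G C X) → StronglyConnected G (_∖_ G S X) →
          StronglyConnected G (_∖_ G (C ∪ S) X)
  sc-∪∖ {C} {S} {X} z z∈C z∈S scC scS p q (p∈C∪S , p∉X) (q∈C∪S , q∉X) = toHub p∈C∪S p∉X ++ fromHub q∈C∪S q∉X
    where
    inC : _∖_ G C X ⊆ _∖_ G (C ∪ S) X
    inC (x∈C , x∉X) = inj₁ x∈C , x∉X
    inS : _∖_ G S X ⊆ _∖_ G (C ∪ S) X
    inS (x∈S , x∉X) = inj₂ x∈S , x∉X
    toHub : ∀ {p} → p ∈ C ∪ S → p ∉ X → Walk G (_∖_ G (C ∪ S) X) p z
    toHub (inj₁ p∈C) p∉X = weaken inC (scC _ z (p∈C , p∉X) z∈C)
    toHub (inj₂ p∈S) p∉X = weaken inS (scS _ z (p∈S , p∉X) z∈S)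
    fromHub : ∀ {q} → q ∈ C ∪ S → q ∉ X → Walk G (_∖_ G (C ∪ S) X) z q
    fromHub (inj₁ q∈C) q∉X = weaken inC (scC z _ z∈C (q∈C , q∉X))
    fromHub (inj₂ q∈S) q∉X = weaken inS (scS z _ z∈S (q∈S , q∉X))

  -- Two 2-vertex-connected sets sharing two distinct vertices have a
  -- 2-vertex-connected union: removing one vertex leaves a common vertex.
  tvc-∪ : ∀ {C S : VSet n} {a b} → TwoVertexConnected G C → TwoVertexConnected G S → a ≢ b →
          a ∈ C → b ∈ C → a ∈ S → b ∈ S → TwoVertexConnected G (C ∪ S)
  tvc-∪ {C} {S} {a} {b} tC@((x , y , z , x∈C , y∈C , z∈C , distinct) , scC , _) tS@(_ , scS , _) a≢b a∈C b∈C a∈S b∈S =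
    (x , y , z , inj₁ x∈C , inj₁ y∈C , inj₁ z∈C , distinct)
    , sc-∪∖ a (a∈C , λ ()) (a∈S , λ ()) scC scS
    , λ w _ → commonAvoiding w (a ≟ w)
    where
    commonAvoiding : ∀ w → Dec (a ≡ w) → StronglyConnected G ((C ∪ S) ⊖ w)
    commonAvoiding w (yes refl) = sc-∪∖ b (b∈C , a≢b ∘ sym) (b∈S , a≢b ∘ sym) (sc-⊖ tC a) (sc-⊖ tS a)
    commonAvoiding w (no a≢w)   = sc-∪∖ a (a∈C , a≢w) (a∈S , a≢w) (sc-⊖ tC w) (sc-⊖ tS w)

  -- Membership in a 2-vertex-connected component is decidable: x ∈ C iff some
  -- coded 2-vertex-connected set contains x and two fixed distinct vertices of C.
  component? : ∀ {C : VSet n} → TwoVCC G C → Decidable C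
  component? {C} (tC@((a , b , _ , a∈C , b∈C , _ , a≢b , _) , _) , maximal) x with anySubset? joinsAt?
    where
    joinsAt? : ∀ S → Dec (TwoVertexConnected G ⟦ S ⟧ × a ∈ ⟦ S ⟧ × b ∈ ⟦ S ⟧ × x ∈ ⟦ S ⟧)
    joinsAt? S = tvc? (λ y → lookup S y Bool.≟ true) ×-dec (lookup S a Bool.≟ true)
                 ×-dec (lookup S b Bool.≟ true) ×-dec (lookup S x Bool.≟ true)
  ... | yes (S , tS , a∈S , b∈S , x∈S) = yes (maximal _ inj₁ (tvc-∪ tC tS a≢b a∈C b∈C a∈S b∈S) (inj₂ x∈S))
  ... | no noSet = no λ x∈C → ¬¬-decidable C λ C? →
    noSet (code C? , tvc-≐ (code-⊆ C?) (code-⊇ C?) tC , code-⊆ C? a∈C , code-⊆ C? b∈C , code-⊆ C? x∈C)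

  -- w dominates u iff there is no walk from v to u avoiding w.
  dominates? : ∀ v w u → Dec (Dominates G v w u)
  dominates? v w u with walk? (remove? {Full G} (λ _ → yes tt) w) v u
  ... | yes p = no λ dom → proj₂ (visited-in p (visits-weaken _ p (dom (toFull p)))) refl
  ... | no ¬p = yes λ p → avoided p (visits? w p)
    where
    avoided : (p : Walk G (Full G) v u) → Dec (Visits G w p) → Visits G w p
    avoided p (yes v) = v
    avoided p (no ¬v) = ⊥-elim (¬p (avoid p ¬v))

  dominates-root : ∀ {v w} → Dominates G v w v → w ≡ v
  dominates-root dom with dom (here tt)
  ... | vhere = refl

  dominates-along : ∀ {v d u x U} → Dominates G v d u → Walk G U x u → d ∉ U → Dominates G v d x
  dominates-along dom q d∉U p with visits-++ p (toFull q) (dom (p ++ toFull q))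
  ... | inj₁ v = v
  ... | inj₂ v = ⊥-elim (d∉U (visited-in q (visits-weaken _ q v)))

  dominates-before : ∀ {v d w a U} → Dominates G v d a → (r : Walk G U w a) → (Visits G d r → d ≡ w) →
                     Dominates G v d w
  dominates-before dom r onlyAtStart p with visits-++ p (toFull r) (dom (p ++ toFull r))
  ... | inj₁ v = v
  ... | inj₂ v = subst (λ d → Visits G d p) (sym (onlyAtStart (visits-weaken _ r v))) (visits-end p)

  -- u is a child of w in DT(v) once w is a proper dominator of u dominated by all
  -- other proper dominators; u ≠ v is automatic since the root has no proper dominator.
  child-of : ∀ {v w u} → Dominates G v w u → w ≢ u →
             (∀ d → Dominates G v d u → d ≢ u → Dominates G v d w) → ChildInDT G v w u
  child-of dom w≢u dominatesW = (λ { refl → w≢u (dominates-root dom) }) , w≢u , dom , dominatesW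

module _ {n : ℕ} (G : Digraph n) {C : VSet n} (tC : TwoVertexConnected G C) (v : Fin n) where

  spread : ∀ {d u} → u ∈ C → d ≢ u → Dominates G v d u → ∀ x → x ∈ C → x ≢ d → Dominates G v d x
  spread {d} u∈C d≢u dom x x∈C x≢d =
    dominates-along G dom (sc-⊖ G tC d x _ (x∈C , x≢d) (u∈C , d≢u ∘ sym)) (λ d∈C⊖d → proj₂ d∈C⊖d refl)

  spread-outside : ∀ {d x} → x ∈ C → d ∉ C → Dominates G v d x → ∀ u → u ∈ C → Dominates G v d u
  spread-outside x∈C d∉C dom u u∈C = spread x∈C (λ { refl → d∉C x∈C }) dom u u∈C (λ { refl → d∉C u∈C })

  InternalDomination : Set
  InternalDomination = ∃ λ c → ∃ λ u → c ∈ C × u ∈ C × u ≢ c × Dominates G v c u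

  internalDomination? : Decidable C → Dec InternalDomination
  internalDomination? C? =
    any? λ c → any? λ u → C? c ×-dec C? u ×-dec ¬? (u ≟ c) ×-dec dominates? G v c u

  childrenOfInternal : ∀ c {u₀} → c ∈ C → u₀ ∈ C → u₀ ≢ c → Dominates G v c u₀ →
                       ∀ u → u ∈ C → u ≢ c → ChildInDT G v c u
  childrenOfInternal c c∈C u₀∈C u₀≢c dom u u∈C u≢c =
    child-of G (spread u₀∈C (u₀≢c ∘ sym) dom u u∈C u≢c) (u≢c ∘ sym) dominatesC
    where
    dominatesC : ∀ d → Dominates G v d u → d ≢ u → Dominates G v d c
    dominatesC d domU d≢u with d ≟ c
    ... | yes refl = visits-end G
    ... | no d≢c   = spread u∈C d≢u domU c c∈C (d≢c ∘ sym)

  twoVertices : ∃ λ a → ∃ λ b → a ∈ C × b ∈ C × a ≢ b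
  twoVertices = let ((a , b , _ , a∈C , b∈C , _ , a≢b , _) , _) = tC in a , b , a∈C , b∈C , a≢b

  -- Without internal domination the root lies outside C, as it dominates every vertex.
  root-outside : ¬ InternalDomination → v ∉ C
  root-outside none v∈C with twoVertices
  ... | (a , b , a∈C , b∈C , a≢b) with a ≟ v
  ...   | yes refl = none (a , b , a∈C , b∈C , a≢b ∘ sym , visits-start G)
  ...   | no a≢v   = none (v , a , v∈C , a∈C , a≢v , visits-start G)

  -- Case 2: if no vertex of C dominates another, then on a walk v ⇝ a (a ∈ C) the
  -- last vertex w outside C that dominates a has all of C as children.
  childrenOfExternal : Decidable C → StronglyConnected G (Full G) → ¬ InternalDomination →
                       ∃[ w ] (w ∉ C × (∀ u → u ∈ C → ChildInDT G v w u))
  childrenOfExternal C? scG none with twoVertices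
  ... | (a , _ , a∈C , _) with lastVisit G Q? (scG v a tt tt)
    where
    Q : VSet n
    Q x = x ∉ C × Dominates G v x a
    Q? : Decidable Q
    Q? x = ¬? (C? x) ×-dec dominates? G v x a
  ...   | inj₂ noQ = ⊥-elim (noQ v (root-outside none , visits-start G) (visits-start G (scG v a tt tt)))
  ...   | inj₁ (w , (w∉C , w-dom-a) , r , lastQ) = w , w∉C , λ u u∈C →
    child-of G (spread-outside a∈C w∉C w-dom-a u u∈C) (λ { refl → w∉C u∈C }) (dominatesW u u∈C)
    where
    -- Any other dominator of a vertex of C is outside C, dominates a, and so
    -- dominates w by the choice of w as the last such vertex.
    dominatesW : ∀ u → u ∈ C → ∀ d → Dominates G v d u → d ≢ u → Dominates G v d w
    dominatesW u u∈C d dom d≢u with C? d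
    ... | yes d∈C = ⊥-elim (none (d , u , d∈C , u∈C , d≢u ∘ sym , dom))
    ... | no d∉C  = dominates-before G domA r (lastQ d (d∉C , domA))
      where
      domA : Dominates G v d a
      domA = spread-outside u∈C d∉C dom a a∈C

theorem3 : (n : ℕ) (G : Digraph n) → StronglyConnected G (Full G) →
    (v : Fin n) (C : VSet n) → TwoVCC G C →
    (∃[ w ] (w ∉ C × (∀ u → u ∈ C → ChildInDT G v w u)))
    ⊎ (∃[ w ] (w ∈ C × (∀ u → u ∈ C → u ≢ w → ChildInDT G v w u)))
theorem3 n G scG v C hC@(tC , _) with internalDomination? G tC v (component? G hC)
... | yes (c , u₀ , c∈C , u₀∈C , u₀≢c , dom) = inj₂ (c , c∈C , childrenOfInternal G tC v c c∈C u₀∈C u₀≢c dom)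
... | no none = inj₁ (childrenOfExternal G tC v (component? G hC) scG none)
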